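{- Let $n,m\ge1$, $R\le D_4$ with $r^2f\in R$, and $T$ a set of tile designs for $R$. Let $\mathrm{Fix}^{\mathrm{cyl}}_{r^2f}(n,m)=\sum_{a\in\mathbb{Z}/n\mathbb{Z}}|X^{(a,r^2f)}|$, where $X^{(a,r^2f)}$ is the set of tilings of the $n\times m$ cylinder fixed by $(a,r^2f)$. Then $$\mathrm{Fix}^{\mathrm{cyl}}_{r^2f}(n,m)=\sum_{d\mid n}\varphi(d)\,t_{\mathrm{id}}^{nm/\mathrm{lcm}(d,2)}\quad\text{if } m \text{ is even},$$ $$\mathrm{Fix}^{\mathrm{cyl}}_{r^2f}(n,m)=\sum_{d\mid n}\varphi(d)\,t_{\mathrm{id}}^{(nm-n)/\mathrm{lcm}(d,2)}\,t_{(r^2f)^d}^{n/d}\quad\text{if } m \text{ is odd},$$ where $\varphi$ is Euler's totient function.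
   Context: Cells: $\mathbb{Z}/n\mathbb{Z}\times\mathbb{Z}/m\mathbb{Z}$. $D_4=\langle r^2,f\mid (r^2)^2=f^2=\mathrm{id}\rangle$ acts on cells on the right by $(x,y)\cdot f=(n-1-x,y)$, $(x,y)\cdot r^2=(n-1-x,m-1-y)$, hence $(x,y)\cdot r^2f=(x,m-1-y)$. For $a\in\mathbb{Z}/n\mathbb{Z}$ and $g\in R$, $(x,y)\cdot(a,g)=(x+a,y)\cdot g$. A set of tile designs for $R$ is a finite set $T$ with a right $R$-action; $t_g=|\{d\in T:d\cdot g=d\}|$. A tiling is a map $\tau$ from cells to $T$; $\tau$ is fixed by $(a,g)$ if $\tau(c\cdot(a,g))=\tau(c)\cdot g$ for all cells $c$. -}

module Defs where

open import Data.Bool using (Bool; true; false; T)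
open import Data.Unit using (tt)
open import Data.Empty using (⊥)
open import Data.Nat using (ℕ; zero; suc; _+_; _*_; _∸_; NonZero; ≢-nonZero; _≟_)
open import Data.Nat.Properties using (*-zeroʳ)
open import Data.Nat.DivMod using (_%_; m%n<n)
open import Data.Nat.GCD using (gcd)
open import Data.Nat.LCM using (lcm; gcd*lcm)
open import Data.Fin using (Fin; toℕ; fromℕ<) renaming (zero to fzero; suc to fsuc)
open import Data.Fin.Properties using () renaming (_≟_ to _≟ᶠ_)
open import Data.List using (List; []; _∷_; map; concatMap; length; filter; allFin; upTo)
open import Data.Nat.ListAction using (sum)
open import Level using (0ℓ)
open import Data.Product using (_×_; _,_)
open import Relation.Binary.PropositionalEquality using (_≡_; refl; sym; trans; subst; cong)
open import Relation.Nullary using (Dec; yes; no; ¬_)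
open import Relation.Nullary.Decidable using (_×-dec_)
open import Relation.Unary using (Pred; Decidable)

-- The group D4 = ⟨ r², f | (r²)² = f² = id ⟩ (commuting generators;
-- the Klein four-group {id, r², f, r²f}).

data D4 : Set where
  e r2 f r2f : D4

infixl 7 _·_
_·_ : D4 → D4 → D4
e   · h   = h
g   · e   = g
r2  · r2  = e
r2  · f   = r2f
r2  · r2f = f
f   · r2  = r2f
f   · f   = e
f   · r2f = r2
r2f · r2  = f
r2f · f   = r2
r2f · r2f = e

pow : D4 → ℕ → D4
pow g zero    = e
pow g (suc d) = g · pow g d

-- A subgroup R ≤ D4, given by a Boolean membership predicate.
-- (Every element of D4 is its own inverse, so closure under the identity
-- and products suffices.)

record Subgroup : Set where
  field
    inR    : D4 → Bool
    id∈    : T (inR e)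
    closed : ∀ g h → T (inR g) → T (inR h) → T (inR (g · h))

open Subgroup public

pow∈ : (R : Subgroup) (g : D4) → T (inR R g) → (d : ℕ) → T (inR R (pow g d))
pow∈ R g p zero    = id∈ R
pow∈ R g p (suc d) = closed R g (pow g d) p (pow∈ R g p d)

record TileDesigns (R : Subgroup) (k : ℕ) : Set where
  field
    act     : (g : D4) → T (inR R g) → Fin k → Fin k
    act-id  : ∀ d → act e (id∈ R) d ≡ d
    act-mul : ∀ g h (pg : T (inR R g)) (ph : T (inR R h)) d →
              act h ph (act g pg d) ≡ act (g · h) (closed R g h pg ph) d

open TileDesigns public

count : ∀ {A : Set} {P : Pred A 0ℓ} → Decidable P → List A → ℕ
count P? xs = length (filter P? xs)

tfix : ∀ {R k} → TileDesigns R k → (g : D4) → T (inR R g) → ℕ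
tfix {k = k} Td g p = count (λ d → act Td g p d ≟ᶠ d) (allFin k)

cons : ∀ {A : Set} {N} → A → (Fin N → A) → Fin (suc N) → A
cons a h fzero    = a
cons a h (fsuc i) = h i

allFuns : ∀ {A : Set} → List A → (N : ℕ) → List (Fin N → A)
allFuns xs zero    = (λ ()) ∷ []
allFuns xs (suc N) = concatMap (λ a → map (cons a) (allFuns xs N)) xs

_+ₙ_ : ∀ {n} .{{_ : NonZero n}} → Fin n → Fin n → Fin n
_+ₙ_ {n} x a = fromℕ< (m%n<n (toℕ x + toℕ a) n)

flipY : ∀ {m} → Fin m → Fin m
flipY = Data.Fin.opposite

Tiling : ℕ → ℕ → ℕ → Set
Tiling n m k = Fin n → Fin m → Fin k

allTilings : (n m k : ℕ) → List (Tiling n m k)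
allTilings n m k = allFuns (allFuns (allFin k) m) n

FixedBy : ∀ {n m k R} .{{_ : NonZero n}} → (Td : TileDesigns R k) →
          T (inR R r2f) → Fin n → Tiling n m k → Set
FixedBy {n} {m} Td p a τ =
  ∀ (x : Fin n) (y : Fin m) → τ (x +ₙ a) (flipY y) ≡ act Td r2f p (τ x y)

private
  allDec : ∀ {N} {P : Fin N → Set} → (∀ i → Dec (P i)) → Dec (∀ i → P i)
  allDec {zero}  P? = yes (λ ())
  allDec {suc N} {P} P? with P? fzero | allDec {N} {λ i → P (fsuc i)} (λ i → P? (fsuc i))
  ... | yes p | yes q = yes (λ { fzero → p ; (fsuc i) → q i })
  ... | no ¬p | _     = no (λ h → ¬p (h fzero))
  ... | _     | no ¬q = no (λ h → ¬q (λ i → h (fsuc i)))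

fixedBy? : ∀ {n m k R} .{{_ : NonZero n}} → (Td : TileDesigns R k) →
           (p : T (inR R r2f)) → (a : Fin n) → Decidable (FixedBy {n} {m} Td p a)
fixedBy? Td p a τ = allDec (λ x → allDec (λ y → τ (x +ₙ a) (flipY y) ≟ᶠ act Td r2f p (τ x y)))

numFixed : ∀ {k R} (n m : ℕ) .{{_ : NonZero n}} → TileDesigns R k →
           T (inR R r2f) → Fin n → ℕ
numFixed {k} n m Td p a = count (fixedBy? {n} {m} Td p a) (allTilings n m k)

FixCyl : ∀ {k R} (n m : ℕ) .{{_ : NonZero n}} → TileDesigns R k →
         T (inR R r2f) → ℕ
FixCyl n m Td p = sum (map (numFixed n m Td p) (allFin n))

φ : ℕ → ℕ
φ d = count (λ i → gcd (suc i) d ≟ 1) (upTo d)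

lcm-d-2-nonZero : ∀ i → NonZero (lcm (suc i) 2)
lcm-d-2-nonZero i = ≢-nonZero λ eq →
  helper (trans (sym (gcd*lcm (suc i) 2)) (trans (cong (gcd (suc i) 2 *_) eq) (*-zeroʳ (gcd (suc i) 2))))
  where
  helper : ¬ (suc i * 2 ≡ 0)
  helper ()

-- Σ_{d ∣ n} f d, with d ranging over 1..n and d written suc i
open import Data.Nat.Divisibility using (_∣_; _∣?_)
sumDiv : (n : ℕ) → ((i : ℕ) → ℕ) → ℕ
sumDiv n g = sum (map g (filter (λ i → suc i ∣? n) (upTo n)))

-- A tiling fixed by (a, r²f) is a map τ from ℤ/n to columns with τ (x + a) = G (τ x), where
-- G c = r²f ∘ c ∘ (y ↦ m - 1 - y) is an involution on columns. The orbits of x ↦ x + a are the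
-- gcd(a,n) residue classes modulo gcd(a,n), each of length d = n / gcd(a,n), so τ amounts to a free
-- choice, at every residue, of a column c with G^d c = c; hence |X^(a,r²f)| = C_d ^ (n/d). For even d
-- every column qualifies and C_d = t_id^m; for odd d, C_d counts the G-symmetric columns, which pair
-- row y with row m - 1 - y and leave a middle row fixed by r²f when m is odd, so
-- C_d = t_id^⌊m/2⌋ · t_{r²f}^(m mod 2). Finally a ↦ n / gcd(a,n) takes every divisor d of n exactly
-- φ(d) times.

module Submission where

open import Defs
open import Data.Bool using (T)
open import Data.Bool.Properties using (T-irrelevant)
open import Data.Empty using (⊥-elim)
open import Data.Nat using (ℕ; zero; suc; _+_; _*_; _∸_; _^_; _≤_; _<_; s≤s; z<s; s<s; pred; NonZero; _≟_; ≢-nonZero; ≢-nonZero⁻¹)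
open import Data.Nat.Properties
open import Data.Nat.DivMod
open import Data.Nat.LCM using (lcm)
open import Data.Nat.GCD
  using (gcd; module GCD; gcd-GCD; module Bézout; gcd[m,n]≢0; gcd[m,n]∣m; gcd[m,n]∣n; n/gcd[m,n]≢0; gcd-identityˡ; c*gcd[m,n]≡gcd[cm,cn])
open import Data.Nat.Coprimality using (Coprime; coprime-Bézout; coprime-/gcd)
open import Data.Nat.Divisibility using (_∣_; divides; _∣?_; ∣⇒≤; ∣m+n∣m⇒∣n; n∣m*n; ∣-refl; ∣-trans; 1∣_)
open import Data.Fin using (Fin; toℕ; opposite; inject₁; fromℕ) renaming (zero to fzero; suc to fsuc)
open import Data.Fin.Properties using (all?) renaming (_≟_ to _≟ᶠ_)
import Data.Fin.Properties as Fin
import Data.Fin.Relation.Unary.Top as Top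
open import Data.List using (List; []; _∷_; _++_; map; concatMap; filter; allFin; upTo; applyUpTo)
open import Data.List.Properties using (map-tabulate)
open import Data.Nat.ListAction using (sum)
open import Data.Product using (_×_; _,_; ∃; proj₁; proj₂)
open import Data.Sum using (inj₂)
open import Data.Nat.Tactic.RingSolver using (solve-∀)
open import Data.Vec.Functional using (Vector)
open import Data.Vec.Functional.Relation.Binary.Pointwise using (Pointwise)
import Data.Vec.Functional.Relation.Binary.Pointwise.Properties as Pointwise
open import Function using (_∘_; id)
open import Data.Nat.GeneralisedArithmetic using (fold)
open import Level using (0ℓ)
open import Relation.Binary.Bundles using (DecSetoid; Setoid)
import Relation.Binary.Reasoning.Setoid as SetoidReasoning
open import Relation.Binary.PropositionalEquality
open import Relation.Nullary using (Dec; yes; no; ¬_)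
open import Relation.Nullary.Decidable using (_×-dec_)
open import Relation.Unary using (Pred; Decidable)

private variable
  A B : Set

ind : ∀ {P : Set} → Dec P → ℕ
ind (yes _) = 1
ind (no _)  = 0

ind-⇔ : ∀ {P Q : Set} (p : Dec P) (q : Dec Q) → (P → Q) → (Q → P) → ind p ≡ ind q
ind-⇔ (yes _) (yes _) _ _ = refl
ind-⇔ (yes p) (no ¬q) p→q _ = ⊥-elim (¬q (p→q p))
ind-⇔ (no ¬p) (yes q) _ q→p = ⊥-elim (¬p (q→p q))
ind-⇔ (no _)  (no _)  _ _ = refl

ind-× : ∀ {P Q : Set} (p : Dec P) (q : Dec Q) → ind p * ind q ≡ ind (p ×-dec q)
ind-× (yes _) (yes _) = refl
ind-× (yes _) (no _)  = refl
ind-× (no _)  _       = refl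

ind-yes : ∀ {P : Set} (p : Dec P) → P → ind p ≡ 1
ind-yes (yes _) _  = refl
ind-yes (no ¬p) pp = ⊥-elim (¬p pp)

ind-no : ∀ {P : Set} (p : Dec P) → ¬ P → ind p ≡ 0
ind-no (yes pp) ¬p = ⊥-elim (¬p pp)
ind-no (no _)   _  = refl

sumOver : List A → (A → ℕ) → ℕ
sumOver []       h = 0
sumOver (x ∷ xs) h = h x + sumOver xs h

sumOver-cong : ∀ (xs : List A) {h h′ : A → ℕ} → (∀ x → h x ≡ h′ x) → sumOver xs h ≡ sumOver xs h′
sumOver-cong []       eq = refl
sumOver-cong (x ∷ xs) eq = cong₂ _+_ (eq x) (sumOver-cong xs eq)

sumOver-++ : ∀ (xs ys : List A) h → sumOver (xs ++ ys) h ≡ sumOver xs h + sumOver ys h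
sumOver-++ []       ys h = refl
sumOver-++ (x ∷ xs) ys h = trans (cong (h x +_) (sumOver-++ xs ys h)) (sym (+-assoc (h x) _ _))

sumOver-map : ∀ (g : B → A) (xs : List B) h → sumOver (map g xs) h ≡ sumOver xs (h ∘ g)
sumOver-map g []       h = refl
sumOver-map g (x ∷ xs) h = cong (h (g x) +_) (sumOver-map g xs h)

sumOver-concatMap : ∀ (g : B → List A) (xs : List B) h →
                    sumOver (concatMap g xs) h ≡ sumOver xs (λ x → sumOver (g x) h)
sumOver-concatMap g []       h = refl
sumOver-concatMap g (x ∷ xs) h =
  trans (sumOver-++ (g x) (concatMap g xs) h) (cong (sumOver (g x) h +_) (sumOver-concatMap g xs h))

sumOver-zero : ∀ (xs : List A) → sumOver xs (λ _ → 0) ≡ 0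
sumOver-zero []       = refl
sumOver-zero (x ∷ xs) = sumOver-zero xs

sumOver-+ : ∀ (xs : List A) h h′ → sumOver xs (λ x → h x + h′ x) ≡ sumOver xs h + sumOver xs h′
sumOver-+ []       h h′ = refl
sumOver-+ (x ∷ xs) h h′ rewrite sumOver-+ xs h h′ = +-+-comm (h x) (h′ x) _ _
  where +-+-comm : ∀ a b c d → a + b + (c + d) ≡ a + c + (b + d)
        +-+-comm = solve-∀

sumOver-*ˡ : ∀ (xs : List A) c h → sumOver xs (λ x → c * h x) ≡ c * sumOver xs h
sumOver-*ˡ []       c h = sym (*-zeroʳ c)
sumOver-*ˡ (x ∷ xs) c h =
  trans (cong (c * h x +_) (sumOver-*ˡ xs c h)) (sym (*-distribˡ-+ c (h x) (sumOver xs h)))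

sumOver-*ʳ : ∀ (xs : List A) c h → sumOver xs (λ x → h x * c) ≡ sumOver xs h * c
sumOver-*ʳ xs c h = trans (sumOver-cong xs (λ x → *-comm (h x) c)) (trans (sumOver-*ˡ xs c h) (*-comm c _))

sumOver-comm : ∀ (xs : List A) (ys : List B) (h : A → B → ℕ) →
               sumOver xs (λ x → sumOver ys (h x)) ≡ sumOver ys (λ y → sumOver xs (λ x → h x y))
sumOver-comm []       ys h = sym (sumOver-zero ys)
sumOver-comm (x ∷ xs) ys h =
  trans (cong (sumOver ys (h x) +_) (sumOver-comm xs ys h))
        (sym (sumOver-+ ys (h x) (λ y → sumOver xs (λ x′ → h x′ y))))

sum-map : ∀ (h : A → ℕ) xs → sum (map h xs) ≡ sumOver xs h
sum-map h []       = refl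
sum-map h (x ∷ xs) = cong (h x +_) (sum-map h xs)

sumOver-filter : ∀ {P : Pred A 0ℓ} (P? : Decidable P) xs h →
                 sumOver (filter P? xs) h ≡ sumOver xs (λ x → ind (P? x) * h x)
sumOver-filter P? []       h = refl
sumOver-filter P? (x ∷ xs) h with P? x
... | yes _ = cong₂ _+_ (sym (+-identityʳ (h x))) (sumOver-filter P? xs h)
... | no _  = sumOver-filter P? xs h

count≡sumOver : ∀ {P : Pred A 0ℓ} (P? : Decidable P) xs → count P? xs ≡ sumOver xs (ind ∘ P?)
count≡sumOver P? []       = refl
count≡sumOver P? (x ∷ xs) with P? x
... | yes _ = cong suc (count≡sumOver P? xs)
... | no _  = count≡sumOver P? xs

sumOver-allFin-suc : ∀ {N} (h : Fin (suc N) → ℕ) →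
                     sumOver (allFin (suc N)) h ≡ h fzero + sumOver (allFin N) (h ∘ fsuc)
sumOver-allFin-suc {N} h = cong (h fzero +_)
  (trans (cong (λ xs → sumOver xs h) (sym (map-tabulate id fsuc))) (sumOver-map fsuc (allFin N) h))

sumOver-allFin-const : ∀ N c → sumOver (allFin N) (λ _ → c) ≡ N * c
sumOver-allFin-const zero    c = refl
sumOver-allFin-const (suc N) c = trans (sumOver-allFin-suc {N} (λ _ → c)) (cong (c +_) (sumOver-allFin-const N c))

productFin : (N : ℕ) → (Fin N → ℕ) → ℕ
productFin zero    w = 1
productFin (suc N) w = w fzero * productFin N (w ∘ fsuc)

productFin-cong : ∀ N {w w′ : Fin N → ℕ} → (∀ i → w i ≡ w′ i) → productFin N w ≡ productFin N w′
productFin-cong zero    eq = refl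
productFin-cong (suc N) eq = cong₂ _*_ (eq fzero) (productFin-cong N (eq ∘ fsuc))

productFin-const : ∀ N c → productFin N (λ _ → c) ≡ c ^ N
productFin-const zero    c = refl
productFin-const (suc N) c = cong (c *_) (productFin-const N c)

ind-∀ : ∀ {N} {P : Fin N → Set} (P? : ∀ i → Dec (P i)) (all : Dec (∀ i → P i)) →
        ind all ≡ productFin N (ind ∘ P?)
ind-∀ {zero}  P? all = ind-yes all (λ ())
ind-∀ {suc N} {P} P? all = begin
    ind all
  ≡⟨ ind-⇔ all (P? fzero ×-dec rest) (λ p → p fzero , p ∘ fsuc)
           (λ { (p₀ , p) fzero → p₀ ; (p₀ , p) (fsuc i) → p i }) ⟩
    ind (P? fzero ×-dec rest)
  ≡⟨ sym (ind-× (P? fzero) rest) ⟩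
    ind (P? fzero) * ind rest
  ≡⟨ cong (ind (P? fzero) *_) (ind-∀ (P? ∘ fsuc) rest) ⟩
    productFin (suc N) (ind ∘ P?)
  ∎
  where
  open ≡-Reasoning
  rest : Dec (∀ i → P (fsuc i))
  rest = all? (P? ∘ fsuc)

module FunctionCounting (S : DecSetoid 0ℓ 0ℓ) (xs : List (DecSetoid.Carrier S))
  (xs-once : ∀ b → sumOver xs (λ a → ind (DecSetoid._≟_ S a b)) ≡ 1) where

  open DecSetoid S using (_≈_) renaming (Carrier to C; _≟_ to _≈?_; sym to ≈-sym; trans to ≈-trans)

  infix 4 _≋_ _≋?_
  _≋_ : ∀ {N} → Vector C N → Vector C N → Set
  _≋_ = Pointwise _≈_

  _≋?_ : ∀ {N} (φ ψ : Vector C N) → Dec (φ ≋ ψ)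
  _≋?_ = Pointwise.decidable _≈?_

  vecSetoid : ℕ → DecSetoid 0ℓ 0ℓ
  vecSetoid = Pointwise.decSetoid S

  sumFuns : (N : ℕ) → (Vector C N → ℕ) → ℕ
  sumFuns N = sumOver (allFuns xs N)

  sumFuns-suc : ∀ N h → sumFuns (suc N) h ≡ sumOver xs (λ a → sumFuns N (h ∘ cons a))
  sumFuns-suc N h = trans (sumOver-concatMap (λ a → map (cons a) (allFuns xs N)) xs h)
                          (sumOver-cong xs (λ a → sumOver-map (cons a) (allFuns xs N) h))

  sumFuns-productFin : ∀ N (u : Fin N → C → ℕ) →
    sumFuns N (λ φ → productFin N (λ i → u i (φ i))) ≡ productFin N (λ i → sumOver xs (u i))
  sumFuns-productFin zero    u = refl
  sumFuns-productFin (suc N) u = begin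
      sumFuns (suc N) (λ φ → productFin (suc N) (λ i → u i (φ i)))
    ≡⟨ sumFuns-suc N _ ⟩
      sumOver xs (λ a → sumFuns N (λ φ → u fzero a * productFin N (λ i → u (fsuc i) (φ i))))
    ≡⟨ sumOver-cong xs (λ a → sumOver-*ˡ (allFuns xs N) (u fzero a) _) ⟩
      sumOver xs (λ a → u fzero a * sumFuns N (λ φ → productFin N (λ i → u (fsuc i) (φ i))))
    ≡⟨ sumOver-cong xs (λ a → cong (u fzero a *_) (sumFuns-productFin N (u ∘ fsuc))) ⟩
      sumOver xs (λ a → u fzero a * productFin N (λ i → sumOver xs (u (fsuc i))))
    ≡⟨ sumOver-*ʳ xs _ (u fzero) ⟩
      productFin (suc N) (λ i → sumOver xs (u i))
    ∎
    where open ≡-Reasoning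

  sumFuns-count : ∀ N → sumFuns N (λ _ → 1) ≡ sumOver xs (λ _ → 1) ^ N
  sumFuns-count N = begin
      sumFuns N (λ _ → 1)
    ≡⟨ sumOver-cong (allFuns xs N) (λ _ → sym (trans (productFin-const N 1) (^-zeroˡ N))) ⟩
      sumFuns N (λ φ → productFin N (λ _ → 1))
    ≡⟨ sumFuns-productFin N (λ _ _ → 1) ⟩
      productFin N (λ _ → sumOver xs (λ _ → 1))
    ≡⟨ productFin-const N _ ⟩
      sumOver xs (λ _ → 1) ^ N
    ∎
    where open ≡-Reasoning

  allFuns-once : ∀ N (ψ : Vector C N) → sumFuns N (λ φ → ind (φ ≋? ψ)) ≡ 1
  allFuns-once N ψ = begin
      sumFuns N (λ φ → ind (φ ≋? ψ))
    ≡⟨ sumOver-cong (allFuns xs N) (λ φ → ind-∀ (λ i → φ i ≈? ψ i) (φ ≋? ψ)) ⟩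
      sumFuns N (λ φ → productFin N (λ i → ind (φ i ≈? ψ i)))
    ≡⟨ sumFuns-productFin N (λ i a → ind (a ≈? ψ i)) ⟩
      productFin N (λ i → sumOver xs (λ a → ind (a ≈? ψ i)))
    ≡⟨ productFin-cong N (xs-once ∘ ψ) ⟩
      productFin N (λ _ → 1)
    ≡⟨ trans (productFin-const N 1) (^-zeroˡ N) ⟩
      1
    ∎
    where open ≡-Reasoning

  record Correspondence {N M} (P : Pred (Vector C N) 0ℓ) (Q : Pred (Vector C M) 0ℓ) : Set where
    field
      to       : Vector C N → Vector C M
      from     : Vector C M → Vector C N
      to-cong  : ∀ {φ φ′} → φ ≋ φ′ → to φ ≋ to φ′
      from-cong : ∀ {ψ ψ′} → ψ ≋ ψ′ → from ψ ≋ from ψ′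
      P-resp   : ∀ {φ φ′} → φ ≋ φ′ → P φ → P φ′
      Q-resp   : ∀ {ψ ψ′} → ψ ≋ ψ′ → Q ψ → Q ψ′
      to-Q     : ∀ φ → P φ → Q (to φ)
      from-P   : ∀ ψ → Q ψ → P (from ψ)
      from∘to  : ∀ φ → P φ → from (to φ) ≋ φ
      to∘from  : ∀ ψ → Q ψ → to (from ψ) ≋ ψ

  count-correspondence : ∀ {N M} {P : Pred (Vector C N) 0ℓ} {Q : Pred (Vector C M) 0ℓ} →
    Correspondence P Q → (P? : Decidable P) (Q? : Decidable Q) →
    sumFuns N (ind ∘ P?) ≡ sumFuns M (ind ∘ Q?)
  -- Double counting of the pairs (φ, ψ) with P φ and to φ ≋ ψ.
  count-correspondence {N} {M} {P} {Q} corr P? Q? = begin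
      sumFuns N (ind ∘ P?)
    ≡⟨ sumOver-cong (allFuns xs N) (λ φ →
         sym (trans (cong (ind (P? φ) *_) (allFuns-once′ (to φ))) (*-identityʳ _))) ⟩
      sumFuns N (λ φ → ind (P? φ) * sumFuns M (λ ψ → ind (to φ ≋? ψ)))
    ≡⟨ sumOver-cong (allFuns xs N) (λ φ → sym (sumOver-*ˡ (allFuns xs M) (ind (P? φ)) _)) ⟩
      sumFuns N (λ φ → sumFuns M (λ ψ → ind (P? φ) * ind (to φ ≋? ψ)))
    ≡⟨ sumOver-comm (allFuns xs N) (allFuns xs M) _ ⟩
      sumFuns M (λ ψ → sumFuns N (λ φ → ind (P? φ) * ind (to φ ≋? ψ)))
    ≡⟨ sumOver-cong (allFuns xs M) (λ ψ → sumOver-cong (allFuns xs N) (λ φ → matched φ ψ)) ⟩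
      sumFuns M (λ ψ → sumFuns N (λ φ → ind (Q? ψ) * ind (φ ≋? from ψ)))
    ≡⟨ sumOver-cong (allFuns xs M) (λ ψ → trans (sumOver-*ˡ (allFuns xs N) (ind (Q? ψ)) _)
                                          (trans (cong (ind (Q? ψ) *_) (allFuns-once N (from ψ))) (*-identityʳ _))) ⟩
      sumFuns M (ind ∘ Q?)
    ∎
    where
    open ≡-Reasoning
    open Correspondence corr
    ≋-sym : ∀ {K} {φ ψ : Vector C K} → φ ≋ ψ → ψ ≋ φ
    ≋-sym eq i = ≈-sym (eq i)
    ≋-trans : ∀ {K} {φ ψ χ : Vector C K} → φ ≋ ψ → ψ ≋ χ → φ ≋ χ
    ≋-trans eq eq′ i = ≈-trans (eq i) (eq′ i)
    allFuns-once′ : (φ : Vector C M) → sumFuns M (λ ψ → ind (φ ≋? ψ)) ≡ 1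
    allFuns-once′ φ = trans (sumOver-cong (allFuns xs M) (λ ψ → ind-⇔ (φ ≋? ψ) (ψ ≋? φ) ≋-sym ≋-sym)) (allFuns-once M φ)
    matched : ∀ φ ψ → ind (P? φ) * ind (to φ ≋? ψ) ≡ ind (Q? ψ) * ind (φ ≋? from ψ)
    matched φ ψ = begin
        ind (P? φ) * ind (to φ ≋? ψ)
      ≡⟨ ind-× (P? φ) (to φ ≋? ψ) ⟩
        ind (P? φ ×-dec (to φ ≋? ψ))
      ≡⟨ ind-⇔ (P? φ ×-dec (to φ ≋? ψ)) (Q? ψ ×-dec (φ ≋? from ψ))
           (λ { (p , eq) → Q-resp eq (to-Q φ p) , ≋-trans (≋-sym (from∘to φ p)) (from-cong eq) })
           (λ { (q , eq) → P-resp (≋-sym eq) (from-P ψ q) , ≋-trans (to-cong eq) (to∘from ψ q) }) ⟩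
        ind (Q? ψ ×-dec (φ ≋? from ψ))
      ≡⟨ sym (ind-× (Q? ψ) (φ ≋? from ψ)) ⟩
        ind (Q? ψ) * ind (φ ≋? from ψ)
      ∎

allFin-once : ∀ {k} (b : Fin k) → sumOver (allFin k) (λ a → ind (a ≟ᶠ b)) ≡ 1
allFin-once {suc k} fzero = begin
    sumOver (allFin (suc k)) (λ a → ind (a ≟ᶠ fzero))
  ≡⟨ sumOver-allFin-suc {k} (λ a → ind (a ≟ᶠ fzero)) ⟩
    1 + sumOver (allFin k) (λ a → ind (fsuc a ≟ᶠ fzero))
  ≡⟨ cong (1 +_) (trans (sumOver-cong (allFin k) (λ a → ind-no (fsuc a ≟ᶠ fzero) (λ ()))) (sumOver-zero (allFin k))) ⟩
    1
  ∎
  where open ≡-Reasoning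
allFin-once {suc k} (fsuc b) = begin
    sumOver (allFin (suc k)) (λ a → ind (a ≟ᶠ fsuc b))
  ≡⟨ sumOver-allFin-suc {k} (λ a → ind (a ≟ᶠ fsuc b)) ⟩
    0 + sumOver (allFin k) (λ a → ind (fsuc a ≟ᶠ fsuc b))
  ≡⟨ sumOver-cong (allFin k) (λ a → ind-⇔ (fsuc a ≟ᶠ fsuc b) (a ≟ᶠ b) Fin.suc-injective (cong fsuc)) ⟩
    sumOver (allFin k) (λ a → ind (a ≟ᶠ b))
  ≡⟨ allFin-once b ⟩
    1
  ∎
  where open ≡-Reasoning

opposite-inject₁ : ∀ {m} (i : Fin m) → opposite (inject₁ i) ≡ fsuc (opposite i)
opposite-inject₁ {suc m} fzero    = refl
opposite-inject₁ {suc m} (fsuc i) = cong inject₁ (opposite-inject₁ i)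

opposite-fromℕ : ∀ m → opposite (fromℕ m) ≡ fzero
opposite-fromℕ zero    = refl
opposite-fromℕ (suc m) = cong inject₁ (opposite-fromℕ m)

module Columns {k : ℕ} (g : Fin k → Fin k) (g-involutive : ∀ v → g (g v) ≡ v) where

  open FunctionCounting (Fin.≡-decSetoid k) (allFin k) allFin-once public

  Column : ℕ → Set
  Column = Vector (Fin k)

  flip : ∀ {m} → Column m → Column m
  flip c = g ∘ c ∘ opposite

  flip-cong : ∀ {m} {c c′ : Column m} → c ≋ c′ → flip c ≋ flip c′
  flip-cong eq = cong g ∘ eq ∘ opposite

  flip-involutive : ∀ {m} (c : Column m) → flip (flip c) ≋ c
  flip-involutive c y = trans (g-involutive _) (cong c (Fin.opposite-involutive y))

  flip-fold-even : ∀ {m} h (c : Column m) → fold c flip (h + h) ≋ c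
  flip-fold-even zero    c = λ _ → refl
  flip-fold-even (suc h) c y rewrite +-suc h h = trans (flip-cong (flip-cong (flip-fold-even h c)) y) (flip-involutive c y)

  flip-fold-odd : ∀ {m} h (c : Column m) → fold c flip (suc (h + h)) ≋ flip c
  flip-fold-odd h c = flip-cong (flip-fold-even h c)

  fixedTiles : ℕ
  fixedTiles = sumOver (allFin k) (λ v → ind (g v ≟ᶠ v))

  symmetricColumns : ℕ → ℕ
  symmetricColumns m = sumFuns m (λ c → ind (flip c ≋? c))

  private
    extendTop : ∀ {m} → Column (suc m) → {j : Fin (suc m)} → Top.View j → Fin k
    extendTop v Top.‵fromℕ           = g (v fzero)
    extendTop v (Top.‵inj₁ {i = i} _) = v (fsuc i)

    extend : ∀ {m} → Column (suc m) → Column (suc (suc m))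
    extend v fzero    = v fzero
    extend v (fsuc j) = extendTop v (Top.view j)

    restrict : ∀ {m} → Column (suc (suc m)) → Column (suc m)
    restrict c = cons (c fzero) (c ∘ fsuc ∘ inject₁)

    extend-last : ∀ {m} (v : Column (suc m)) → extend v (fsuc (fromℕ m)) ≡ g (v fzero)
    extend-last {m} v rewrite Top.view-fromℕ m = refl

    extend-inject₁ : ∀ {m} (v : Column (suc m)) i → extend v (fsuc (inject₁ i)) ≡ v (fsuc i)
    extend-inject₁ v i rewrite Top.view-inject₁ i = refl

    opposite-middle : ∀ {m} (i : Fin m) → opposite (fsuc (inject₁ i)) ≡ fsuc (inject₁ (opposite i))
    opposite-middle i = cong inject₁ (opposite-inject₁ i)

    symmetricInside : ∀ {m} → Pred (Column (suc m)) 0ℓ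
    symmetricInside v = flip (v ∘ fsuc) ≋ v ∘ fsuc

    -- A symmetric column of height m + 2 consists of its top entry, which determines the bottom one,
    -- and a symmetric column of height m in between.
    peelEnds : ∀ m → Correspondence {suc (suc m)} (λ c → flip c ≋ c) symmetricInside
    peelEnds m = record
      { to = restrict
      ; from = extend
      ; to-cong = λ { eq fzero → eq fzero ; eq (fsuc i) → eq (fsuc (inject₁ i)) }
      ; from-cong = from-cong
      ; P-resp = λ eq p y → trans (cong g (sym (eq (opposite y)))) (trans (p y) (eq y))
      ; Q-resp = λ eq q i → trans (cong g (sym (eq (fsuc (opposite i))))) (trans (q i) (eq (fsuc i)))
      ; to-Q = λ c p i → trans (cong (g ∘ c) (sym (opposite-middle i))) (p (fsuc (inject₁ i)))
      ; from-P = from-P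
      ; from∘to = from∘to
      ; to∘from = λ { v q fzero → refl ; v q (fsuc i) → extend-inject₁ v i }
      }
      where
      from-cong : ∀ {v v′ : Column (suc m)} → v ≋ v′ → extend v ≋ extend v′
      from-cong eq fzero = eq fzero
      from-cong eq (fsuc j) with Top.view j
      ... | Top.‵fromℕ           = cong g (eq fzero)
      ... | Top.‵inj₁ {i = i} _ = eq (fsuc i)

      from-P : ∀ v → symmetricInside v → flip (extend v) ≋ extend v
      from-P v q fzero = trans (cong g (extend-last v)) (g-involutive (v fzero))
      from-P v q (fsuc j) with Top.view j
      ... | Top.‵fromℕ           = cong (g ∘ extend v) (cong inject₁ (opposite-fromℕ m))
      ... | Top.‵inj₁ {i = i} _ =
        trans (cong (g ∘ extend v) (opposite-middle i)) (trans (cong g (extend-inject₁ v (opposite i))) (q i))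

      from∘to : ∀ c → flip c ≋ c → extend (restrict c) ≋ c
      from∘to c p fzero = refl
      from∘to c p (fsuc j) with Top.view j
      ... | Top.‵fromℕ           = trans (cong g (sym (p fzero))) (g-involutive _)
      ... | Top.‵inj₁ {i = i} _ = refl

  symmetricColumns-+2 : ∀ m → symmetricColumns (suc (suc m)) ≡ k * symmetricColumns m
  symmetricColumns-+2 m = begin
      symmetricColumns (suc (suc m))
    ≡⟨ count-correspondence (peelEnds m) (λ c → flip c ≋? c) (λ v → flip (v ∘ fsuc) ≋? v ∘ fsuc) ⟩
      sumFuns (suc m) (λ v → ind (flip (v ∘ fsuc) ≋? v ∘ fsuc))
    ≡⟨ sumFuns-suc m _ ⟩
      sumOver (allFin k) (λ _ → symmetricColumns m)
    ≡⟨ sumOver-allFin-const k _ ⟩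
      k * symmetricColumns m
    ∎
    where open ≡-Reasoning

  symmetricColumns-even : ∀ h → symmetricColumns (h + h) ≡ k ^ h
  symmetricColumns-even zero    = trans (+-identityʳ _) (ind-yes (flip {0} (λ ()) ≋? (λ ())) (λ ()))
  symmetricColumns-even (suc h) rewrite +-suc h h =
    trans (symmetricColumns-+2 (h + h)) (cong (k *_) (symmetricColumns-even h))

  symmetricColumns-odd : ∀ h → symmetricColumns (suc (h + h)) ≡ k ^ h * fixedTiles
  symmetricColumns-odd zero = begin
      symmetricColumns 1
    ≡⟨ sumFuns-suc 0 _ ⟩
      sumOver (allFin k) (λ a → sumFuns 0 (λ w → ind (flip (cons a w) ≋? cons a w)))
    ≡⟨ sumOver-cong (allFin k) (λ a → trans (+-identityʳ _)
         (ind-⇔ _ (g a ≟ᶠ a) (λ p → p fzero) λ { p fzero → p })) ⟩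
      fixedTiles
    ≡⟨ +-identityʳ _ ⟨
      1 * fixedTiles
    ∎
    where open ≡-Reasoning
  symmetricColumns-odd (suc h) rewrite +-suc h h =
    trans (symmetricColumns-+2 (suc (h + h))) (trans (cong (k *_) (symmetricColumns-odd h)) (sym (*-assoc k _ _)))

  fixedColumns : ℕ → ℕ → ℕ
  fixedColumns m d = sumFuns m (λ c → ind (fold c flip d ≋? c))

  fixedColumns-even : ∀ m h → fixedColumns m (h + h) ≡ k ^ m
  fixedColumns-even m h = begin
      fixedColumns m (h + h)
    ≡⟨ sumOver-cong (allFuns (allFin k) m) (λ c → ind-yes (fold c flip (h + h) ≋? c) (flip-fold-even h c)) ⟩
      sumFuns m (λ _ → 1)
    ≡⟨ sumFuns-count m ⟩
      sumOver (allFin k) (λ _ → 1) ^ m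
    ≡⟨ cong (_^ m) (trans (sumOver-allFin-const k 1) (*-identityʳ k)) ⟩
      k ^ m
    ∎
    where open ≡-Reasoning

  fixedColumns-odd : ∀ m h → fixedColumns m (suc (h + h)) ≡ symmetricColumns m
  fixedColumns-odd m h = sumOver-cong (allFuns (allFin k) m) λ c →
    ind-⇔ (fold c flip (suc (h + h)) ≋? c) (flip c ≋? c)
      (λ p y → trans (sym (flip-fold-odd h c y)) (p y)) (λ p y → trans (flip-fold-odd h c y) (p y))

-- Congruence on ℕ, witnessed without subtraction.
infix 4 _≡_modulo_
data _≡_modulo_ (x y n : ℕ) : Set where
  congruent : ∀ i j → x + i * n ≡ y + j * n → x ≡ y modulo n

module _ {n : ℕ} where

  ≡-mod-refl : ∀ {x} → x ≡ x modulo n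
  ≡-mod-refl = congruent 0 0 refl

  ≡⇒≡-mod : ∀ {x y} → x ≡ y → x ≡ y modulo n
  ≡⇒≡-mod refl = ≡-mod-refl

  ≡-mod-sym : ∀ {x y} → x ≡ y modulo n → y ≡ x modulo n
  ≡-mod-sym (congruent i j eq) = congruent j i (sym eq)

  ≡-mod-trans : ∀ {x y z} → x ≡ y modulo n → y ≡ z modulo n → x ≡ z modulo n
  ≡-mod-trans {x} {y} {z} (congruent i j eq) (congruent i′ j′ eq′) = congruent (i + i′) (j + j′) (begin
      x + (i + i′) * n    ≡⟨ regroup n x i i′ ⟩
      (x + i * n) + i′ * n ≡⟨ cong (_+ i′ * n) eq ⟩
      (y + j * n) + i′ * n ≡⟨ regroup′ n y j i′ ⟩
      (y + i′ * n) + j * n ≡⟨ cong (_+ j * n) eq′ ⟩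
      (z + j′ * n) + j * n ≡⟨ regroup″ n z j′ j ⟩
      z + (j + j′) * n    ∎)
    where
    open ≡-Reasoning
    regroup : ∀ n x i i′ → x + (i + i′) * n ≡ (x + i * n) + i′ * n
    regroup = solve-∀
    regroup′ : ∀ n y j i′ → (y + j * n) + i′ * n ≡ (y + i′ * n) + j * n
    regroup′ = solve-∀
    regroup″ : ∀ n z j′ j → (z + j′ * n) + j * n ≡ z + (j + j′) * n
    regroup″ = solve-∀

  ≡-mod-+ : ∀ {x y x′ y′} → x ≡ y modulo n → x′ ≡ y′ modulo n → x + x′ ≡ y + y′ modulo n
  ≡-mod-+ {x} {y} {x′} {y′} (congruent i j eq) (congruent i′ j′ eq′) = congruent (i + i′) (j + j′) (begin
      x + x′ + (i + i′) * n       ≡⟨ shuffle n x x′ i i′ ⟩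
      (x + i * n) + (x′ + i′ * n) ≡⟨ cong₂ _+_ eq eq′ ⟩
      (y + j * n) + (y′ + j′ * n) ≡⟨ sym (shuffle n y y′ j j′) ⟩
      y + y′ + (j + j′) * n       ∎)
    where
    open ≡-Reasoning
    shuffle : ∀ n x x′ i i′ → x + x′ + (i + i′) * n ≡ (x + i * n) + (x′ + i′ * n)
    shuffle = solve-∀

  ≡-mod-*ʳ : ∀ {x y} c → x ≡ y modulo n → x * c ≡ y * c modulo n
  ≡-mod-*ʳ {x} {y} c (congruent i j eq) = congruent (i * c) (j * c) (begin
      x * c + i * c * n   ≡⟨ distrib n x i c ⟩
      (x + i * n) * c     ≡⟨ cong (_* c) eq ⟩
      (y + j * n) * c     ≡⟨ sym (distrib n y j c) ⟩
      y * c + j * c * n   ∎)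
    where
    open ≡-Reasoning
    distrib : ∀ n x i c → x * c + i * c * n ≡ (x + i * n) * c
    distrib = solve-∀

  ≡-mod-cancelˡ : ∀ x {y z} → x + y ≡ x + z modulo n → y ≡ z modulo n
  ≡-mod-cancelˡ x {y} {z} (congruent i j eq) =
    congruent i j (+-cancelˡ-≡ x _ _ (trans (sym (+-assoc x y (i * n))) (trans eq (+-assoc x z (j * n)))))

  multiple≡0 : ∀ q → q * n ≡ 0 modulo n
  multiple≡0 q = congruent 0 q (+-identityʳ _)

  module _ .{{_ : NonZero n}} where

    %-≡-mod : ∀ x → x % n ≡ x modulo n
    %-≡-mod x = congruent (x / n) 0 (trans (sym (m≡m%n+[m/n]*n x n)) (sym (+-identityʳ x)))

    ≡-mod⇒%≡ : ∀ {x y} → x ≡ y modulo n → x % n ≡ y % n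
    ≡-mod⇒%≡ {x} {y} (congruent i j eq) =
      trans (sym ([m+kn]%n≡m%n x i n)) (trans (cong (_% n) eq) ([m+kn]%n≡m%n y j n))

≡-mod-scale : ∀ {x y d} g → x ≡ y modulo d → x * g ≡ y * g modulo d * g
≡-mod-scale {x} {y} {d} g (congruent i j eq) = congruent i j (begin
    x * g + i * (d * g) ≡⟨ distrib x i d g ⟩
    (x + i * d) * g     ≡⟨ cong (_* g) eq ⟩
    (y + j * d) * g     ≡⟨ sym (distrib y j d g) ⟩
    y * g + j * (d * g) ∎)
  where
  open ≡-Reasoning
  distrib : ∀ x i d g → x * g + i * (d * g) ≡ (x + i * d) * g
  distrib = solve-∀

≡-mod-unscale : ∀ {x y d} g .{{_ : NonZero g}} → x * g ≡ y * g modulo d * g → x ≡ y modulo d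
≡-mod-unscale {x} {y} {d} g (congruent i j eq) = congruent i j
  (*-cancelʳ-≡ (x + i * d) (y + j * d) g (begin
    (x + i * d) * g     ≡⟨ sym (distrib x i d g) ⟩
    x * g + i * (d * g) ≡⟨ eq ⟩
    y * g + j * (d * g) ≡⟨ distrib y j d g ⟩
    (y + j * d) * g     ∎))
  where
  open ≡-Reasoning
  distrib : ∀ x i d g → x * g + i * (d * g) ≡ (x + i * d) * g
  distrib = solve-∀

≡-mod-setoid : ℕ → Setoid 0ℓ 0ℓ
≡-mod-setoid n = record
  { Carrier       = ℕ
  ; _≈_           = λ x y → x ≡ y modulo n
  ; isEquivalence = record { refl = ≡-mod-refl ; sym = ≡-mod-sym ; trans = ≡-mod-trans }
  }

module ≡-mod-Reasoning (n : ℕ) = SetoidReasoning (≡-mod-setoid n)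

inverse-modulo : ∀ {s d} .{{_ : NonZero d}} → Coprime s d → ∃ λ u → u * s ≡ 1 modulo d
inverse-modulo {s} {d} coprime with coprime-Bézout coprime
... | Bézout.+- x y eq = x , congruent 0 y (trans (+-identityʳ _) (sym eq))
... | Bézout.-+ x y eq = x * (d ∸ 1) , congruent y (x * s) (begin
    x * (d ∸ 1) * s + y * d       ≡⟨ cong (x * (d ∸ 1) * s +_) (sym eq) ⟩
    x * (d ∸ 1) * s + (1 + x * s) ≡⟨ regroup x (d ∸ 1) s ⟩
    1 + x * s * suc (d ∸ 1)        ≡⟨ cong (λ e → 1 + x * s * e) (suc-pred d) ⟩
    1 + x * s * d                  ∎)
  where
  open ≡-Reasoning
  regroup : ∀ x d′ s → x * d′ * s + (1 + x * s) ≡ 1 + x * s * suc d′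
  regroup = solve-∀

module OrbitCoordinates (n g′ d s u : ℕ) .{{_ : NonZero n}} .{{_ : NonZero g′}} .{{_ : NonZero d}}
  (n≡d*g′ : n ≡ d * g′) (u*s≡1 : u * s ≡ 1 modulo d) where

  shift : ℕ
  shift = s * g′

  -- shift generates the subgroup g′ℤ/nℤ of order d, and u inverts shift / g′ modulo d, so position X
  -- is reached from its residue X % g′ by steps X shifts.
  steps : ℕ → ℕ
  steps X = (X / g′ * u) % d

  private
    quotient-mod-d : ∀ {x y} → x * g′ ≡ y * g′ modulo n → x ≡ y modulo d
    quotient-mod-d eq = ≡-mod-unscale g′ (subst (λ N → _ ≡ _ modulo N) n≡d*g′ eq)

    scale-mod-n : ∀ {x y} → x ≡ y modulo d → x * g′ ≡ y * g′ modulo n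
    scale-mod-n eq = subst (λ N → _ ≡ _ modulo N) (sym n≡d*g′) (≡-mod-scale g′ eq)

    steps*s : ∀ X → steps X * s ≡ X / g′ modulo d
    steps*s X = begin
        steps X * s        ≈⟨ ≡-mod-*ʳ s (%-≡-mod (X / g′ * u)) ⟩
        X / g′ * u * s     ≡⟨ *-assoc (X / g′) u s ⟩
        X / g′ * (u * s)   ≡⟨ *-comm (X / g′) (u * s) ⟩
        u * s * (X / g′)   ≈⟨ ≡-mod-*ʳ (X / g′) u*s≡1 ⟩
        1 * (X / g′)       ≡⟨ *-identityˡ (X / g′) ⟩
        X / g′             ∎
      where open ≡-mod-Reasoning d

  residue+steps : ∀ X → X % g′ + steps X * shift ≡ X modulo n
  residue+steps X = begin
      X % g′ + steps X * shift   ≡⟨ cong (X % g′ +_) (sym (*-assoc (steps X) s g′)) ⟩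
      X % g′ + steps X * s * g′  ≈⟨ ≡-mod-+ ≡-mod-refl (scale-mod-n (steps*s X)) ⟩
      X % g′ + X / g′ * g′       ≡⟨ sym (m≡m%n+[m/n]*n X g′) ⟩
      X                          ∎
    where open ≡-mod-Reasoning n

  residue-+shift : ∀ X → (X + shift) % n % g′ ≡ X % g′
  residue-+shift X = trans (m∣n⇒o%n%m≡o%m g′ n (X + shift) (divides d n≡d*g′)) ([m+kn]%n≡m%n X s g′)

  steps-+shift : ∀ X → steps ((X + shift) % n) ≡ suc (steps X) % d
  steps-+shift X = ≡-mod⇒%≡ (begin
      Z / g′ * u             ≈⟨ ≡-mod-*ʳ u quotient-shift ⟩
      (X / g′ + s) * u       ≡⟨ *-distribʳ-+ u (X / g′) s ⟩
      X / g′ * u + s * u     ≈⟨ ≡-mod-+ (≡-mod-sym (%-≡-mod (X / g′ * u))) s*u≡1 ⟩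
      steps X + 1            ≡⟨ +-comm (steps X) 1 ⟩
      suc (steps X)          ∎)
    where
    open ≡-mod-Reasoning d
    Z = (X + shift) % n
    s*u≡1 : s * u ≡ 1 modulo d
    s*u≡1 = subst (λ e → e ≡ 1 modulo d) (*-comm u s) u*s≡1
    quotient-shift : Z / g′ ≡ X / g′ + s modulo d
    quotient-shift = quotient-mod-d (≡-mod-cancelˡ (X % g′) (M.begin
        X % g′ + Z / g′ * g′             M.≡⟨ cong (_+ Z / g′ * g′) (sym (residue-+shift X)) ⟩
        Z % g′ + Z / g′ * g′             M.≡⟨ sym (m≡m%n+[m/n]*n Z g′) ⟩
        Z                                M.≈⟨ %-≡-mod (X + shift) ⟩
        X + shift                        M.≡⟨ cong (_+ shift) (m≡m%n+[m/n]*n X g′) ⟩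
        X % g′ + X / g′ * g′ + s * g′    M.≡⟨ +-assoc (X % g′) _ _ ⟩
        X % g′ + (X / g′ * g′ + s * g′)  M.≡⟨ cong (X % g′ +_) (sym (*-distribʳ-+ g′ (X / g′) s)) ⟩
        X % g′ + (X / g′ + s) * g′       M.∎))
      where module M = ≡-mod-Reasoning n

  +d*shift : ∀ Y → Y + d * shift ≡ Y modulo n
  +d*shift Y = begin
      Y + d * shift  ≡⟨ cong (Y +_) (trans (regroup d s g′) (cong (s *_) (sym n≡d*g′))) ⟩
      Y + s * n      ≈⟨ ≡-mod-+ ≡-mod-refl (multiple≡0 s) ⟩
      Y + 0          ≡⟨ +-identityʳ Y ⟩
      Y              ∎
    where
    open ≡-mod-Reasoning n
    regroup : ∀ d s g′ → d * (s * g′) ≡ s * (d * g′)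
    regroup = solve-∀

  steps-residue : ∀ {R} → R < g′ → steps R ≡ 0
  steps-residue R<g′ rewrite m<n⇒m/n≡0 R<g′ = m<n⇒m%n≡m (n≢0⇒n>0 (≢-nonZero⁻¹ d))

toℕ-mod : ∀ X N .{{_ : NonZero N}} → toℕ (X mod N) ≡ X % N
toℕ-mod X N = Fin.toℕ-fromℕ< (m%n<n X N)

toℕ-mod-congruent : ∀ X N .{{_ : NonZero N}} → toℕ (X mod N) ≡ X modulo N
toℕ-mod-congruent X N = subst (λ R → R ≡ X modulo N) (sym (toℕ-mod X N)) (%-≡-mod X)

mod-cong : ∀ {X Y N} .{{_ : NonZero N}} → X % N ≡ Y % N → X mod N ≡ Y mod N
mod-cong {X} {Y} {N} eq = Fin.toℕ-injective (trans (toℕ-mod X N) (trans eq (sym (toℕ-mod Y N))))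

toℕ-mod-inverse : ∀ {N} .{{_ : NonZero N}} (x : Fin N) → toℕ x mod N ≡ x
toℕ-mod-inverse {N} x = Fin.toℕ-injective (trans (toℕ-mod (toℕ x) N) (m<n⇒m%n≡m (Fin.toℕ<n x)))

gcd-nonZero : ∀ x n .{{_ : NonZero n}} → NonZero (gcd x n)
gcd-nonZero x n = ≢-nonZero (gcd[m,n]≢0 x n (inj₂ (≢-nonZero⁻¹ n)))

order : (n : ℕ) .{{_ : NonZero n}} → ℕ → ℕ
order n x = _/_ n (gcd x n) {{gcd-nonZero x n}}

order-nonZero : ∀ n .{{_ : NonZero n}} x → NonZero (order n x)
order-nonZero n x = ≢-nonZero (n/gcd[m,n]≢0 x n {{gcd≢0 = gcd-nonZero x n}})

order*gcd : ∀ n .{{_ : NonZero n}} x → n ≡ order n x * gcd x n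
order*gcd n x = sym (m/n*n≡m {{gcd-nonZero x n}} (gcd[m,n]∣n x n))

module Orbits (S : DecSetoid 0ℓ 0ℓ) (xs : List (DecSetoid.Carrier S))
  (xs-once : ∀ b → sumOver xs (λ a → ind (DecSetoid._≟_ S a b)) ≡ 1)
  (F : DecSetoid.Carrier S → DecSetoid.Carrier S)
  (F-cong : ∀ {v w} → DecSetoid._≈_ S v w → DecSetoid._≈_ S (F v) (F w)) where

  open FunctionCounting S xs xs-once
  open DecSetoid S using (_≈_)
    renaming (Carrier to C; _≟_ to _≈?_; refl to ≈-refl; sym to ≈-sym; trans to ≈-trans; reflexive to ≈-reflexive)

  Equivariant : ∀ {n} .{{_ : NonZero n}} → Fin n → Pred (Vector C n) 0ℓ
  Equivariant a τ = ∀ x → τ (x +ₙ a) ≈ F (τ x)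

  equivariant? : ∀ {n} .{{_ : NonZero n}} (a : Fin n) → Decidable (Equivariant a)
  equivariant? a τ = all? (λ x → τ (x +ₙ a) ≈? F (τ x))

  periodicPoints : ℕ → ℕ
  periodicPoints d = sumOver xs (λ v → ind (fold v F d ≈? v))

  fold-cong : ∀ i {v w} → v ≈ w → fold v F i ≈ fold w F i
  fold-cong zero    eq = eq
  fold-cong (suc i) eq = F-cong (fold-cong i eq)

  fold-+ : ∀ i j v → fold v F (i + j) ≡ fold (fold v F j) F i
  fold-+ zero    j v = refl
  fold-+ (suc i) j v = cong F (fold-+ i j v)

  fold-multiple : ∀ {d v} → fold v F d ≈ v → ∀ q → fold v F (q * d) ≈ v
  fold-multiple period zero    = ≈-refl
  fold-multiple {d} {v} period (suc q) =
    ≈-trans (≈-reflexive (fold-+ d (q * d) v)) (≈-trans (fold-cong d (fold-multiple period q)) period)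

  fold-% : ∀ {d v} .{{_ : NonZero d}} → fold v F d ≈ v → ∀ i → fold v F (i % d) ≈ fold v F i
  fold-% {d} {v} period i = ≈-trans (fold-cong (i % d) (≈-sym (fold-multiple period (i / d))))
    (≈-reflexive (trans (sym (fold-+ (i % d) (i / d * d) v)) (cong (fold v F) (sym (m≡m%n+[m/n]*n i d)))))

  Periodic : ∀ {N} → ℕ → Pred (Vector C N) 0ℓ
  Periodic d c = ∀ r → fold (c r) F d ≈ c r

  module _ (n g′ d s u : ℕ) .{{_ : NonZero n}} .{{_ : NonZero g′}} .{{_ : NonZero d}}
    (n≡d*g′ : n ≡ d * g′) (u*s≡1 : u * s ≡ 1 modulo d) (a : Fin n) (a≡s*g′ : toℕ a ≡ s * g′) where

    open OrbitCoordinates n g′ d s u n≡d*g′ u*s≡1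

    private
      +ₙa : ∀ X → (X + shift) mod n ≡ (X mod n) +ₙ a
      +ₙa X = mod-cong (≡-mod⇒%≡ (≡-mod-+ (≡-mod-sym (toℕ-mod-congruent X n)) (≡⇒≡-mod (sym a≡s*g′))))

      walk : ∀ {τ} → Equivariant a τ → ∀ Y i → τ ((Y + i * shift) mod n) ≈ fold (τ (Y mod n)) F i
      walk {τ} eqv Y zero    = ≈-reflexive (cong (λ X → τ (X mod n)) (+-identityʳ Y))
      walk {τ} eqv Y (suc i) =
        ≈-trans (≈-reflexive (cong τ shifted)) (≈-trans (eqv ((Y + i * shift) mod n)) (F-cong (walk eqv Y i)))
        where
        shifted : (Y + (shift + i * shift)) mod n ≡ ((Y + i * shift) mod n) +ₙ a
        shifted = trans (cong (_mod n) (regroup Y shift (i * shift))) (+ₙa (Y + i * shift))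
          where regroup : ∀ Y a b → Y + (a + b) ≡ Y + b + a
                regroup = solve-∀

      g′≤n : g′ ≤ n
      g′≤n = subst (g′ ≤_) (sym n≡d*g′) (m≤n*m g′ d)

    -- An equivariant τ is determined by its values at the residues 0 … g′ - 1, one in each orbit of
    -- x ↦ x + a, and each of these values must be F^d-periodic.
    orbitRepresentatives : Correspondence {n} {g′} (Equivariant a) (Periodic d)
    orbitRepresentatives = record
      { to        = λ τ r → τ (toℕ r mod n)
      ; from      = from
      ; to-cong   = λ eq r → eq (toℕ r mod n)
      ; from-cong = λ eq x → fold-cong (steps (toℕ x)) (eq (toℕ x mod g′))
      ; P-resp    = λ eq eqv x → ≈-trans (≈-sym (eq (x +ₙ a))) (≈-trans (eqv x) (F-cong (eq x)))
      ; Q-resp    = λ eq per r → ≈-trans (fold-cong d (≈-sym (eq r))) (≈-trans (per r) (eq r))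
      ; to-Q      = λ τ eqv r → ≈-trans (≈-sym (walk eqv (toℕ r) d))
                                        (≈-reflexive (cong τ (mod-cong (≡-mod⇒%≡ (+d*shift (toℕ r))))))
      ; from-P    = from-P
      ; from∘to   = from∘to
      ; to∘from   = to∘from
      }
      where
      from : Vector C g′ → Vector C n
      from c x = fold (c (toℕ x mod g′)) F (steps (toℕ x))

      from-P : ∀ c → Periodic d c → Equivariant a (from c)
      from-P c per x = ≈-trans (≈-reflexive (cong₂ (λ r i → fold (c r) F i) same-residue next-step))
                               (fold-% (per _) (suc (steps X)))
        where
        X = toℕ x
        position : toℕ (x +ₙ a) ≡ (X + shift) % n
        position = trans (toℕ-mod (X + toℕ a) n) (cong (λ e → (X + e) % n) a≡s*g′)
        same-residue : toℕ (x +ₙ a) mod g′ ≡ X mod g′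
        same-residue = mod-cong (trans (cong (_% g′) position) (residue-+shift X))
        next-step : steps (toℕ (x +ₙ a)) ≡ suc (steps X) % d
        next-step = trans (cong steps position) (steps-+shift X)

      from∘to : ∀ τ → Equivariant a τ → ∀ x → from (λ r → τ (toℕ r mod n)) x ≈ τ x
      from∘to τ eqv x = ≈-trans (≈-reflexive (cong (λ R → fold (τ (R mod n)) F (steps X)) (toℕ-mod X g′)))
        (≈-trans (≈-sym (walk eqv (X % g′) (steps X)))
                 (≈-reflexive (cong τ (trans (mod-cong (≡-mod⇒%≡ (residue+steps X))) (toℕ-mod-inverse x)))))
        where X = toℕ x

      to∘from : ∀ c → Periodic d c → ∀ r → from c (toℕ r mod n) ≈ c r
      to∘from c per r = ≈-reflexive (cong₂ (λ r′ i → fold (c r′) F i)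
                          (trans (cong (_mod g′) R′≡R) (toℕ-mod-inverse r))
                          (trans (cong steps R′≡R) (steps-residue (Fin.toℕ<n r))))
        where
        R′≡R : toℕ (toℕ r mod n) ≡ toℕ r
        R′≡R = trans (toℕ-mod (toℕ r) n) (m<n⇒m%n≡m (<-≤-trans (Fin.toℕ<n r) g′≤n))

    count-equivariant-coordinates : sumFuns n (ind ∘ equivariant? a) ≡ periodicPoints d ^ g′
    count-equivariant-coordinates = begin
        sumFuns n (ind ∘ equivariant? a)
      ≡⟨ count-correspondence orbitRepresentatives (equivariant? a) periodic? ⟩
        sumFuns g′ (ind ∘ periodic?)
      ≡⟨ sumOver-cong (allFuns xs g′) (λ c → ind-∀ (λ r → fold (c r) F d ≈? c r) (periodic? c)) ⟩
        sumFuns g′ (λ c → productFin g′ (λ r → ind (fold (c r) F d ≈? c r)))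
      ≡⟨ sumFuns-productFin g′ (λ _ v → ind (fold v F d ≈? v)) ⟩
        productFin g′ (λ _ → periodicPoints d)
      ≡⟨ productFin-const g′ (periodicPoints d) ⟩
        periodicPoints d ^ g′
      ∎
      where
      open ≡-Reasoning
      periodic? : Decidable (Periodic {g′} d)
      periodic? c = all? (λ r → fold (c r) F d ≈? c r)

  count-equivariant : ∀ {n} .{{_ : NonZero n}} (a : Fin n) →
    sumFuns n (ind ∘ equivariant? a) ≡ periodicPoints (order n (toℕ a)) ^ gcd (toℕ a) n
  count-equivariant {n} a =
    count-equivariant-coordinates n (gcd t n) (order n t) s u {{_}} {{gcd-nonZero t n}} {{order-nonZero n t}}
      (order*gcd n t) u*s≡1 a (sym (m/n*n≡m {{gcd-nonZero t n}} (gcd[m,n]∣m t n)))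
    where
    t = toℕ a
    s = _/_ t (gcd t n) {{gcd-nonZero t n}}
    inverse : ∃ λ u → u * s ≡ 1 modulo order n t
    inverse = inverse-modulo {{order-nonZero n t}} (coprime-/gcd t n {{gcd-nonZero t n}})
    u = proj₁ inverse
    u*s≡1 = proj₂ inverse

Σ< : ℕ → (ℕ → ℕ) → ℕ
Σ< zero    w = 0
Σ< (suc n) w = w 0 + Σ< n (w ∘ suc)

Σ<-cong : ∀ n {w w′ : ℕ → ℕ} → (∀ i → i < n → w i ≡ w′ i) → Σ< n w ≡ Σ< n w′
Σ<-cong zero    eq = refl
Σ<-cong (suc n) eq = cong₂ _+_ (eq 0 z<s) (Σ<-cong n (λ i i<n → eq (suc i) (s<s i<n)))

Σ<-zero : ∀ n → Σ< n (λ _ → 0) ≡ 0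
Σ<-zero zero    = refl
Σ<-zero (suc n) = Σ<-zero n

Σ<-+ : ∀ n (w w′ : ℕ → ℕ) → Σ< n (λ i → w i + w′ i) ≡ Σ< n w + Σ< n w′
Σ<-+ zero    w w′ = refl
Σ<-+ (suc n) w w′ rewrite Σ<-+ n (w ∘ suc) (w′ ∘ suc) = +-+-comm (w 0) (w′ 0) _ _
  where +-+-comm : ∀ a b c d → a + b + (c + d) ≡ a + c + (b + d)
        +-+-comm = solve-∀

Σ<-*ˡ : ∀ n c (w : ℕ → ℕ) → Σ< n (λ i → c * w i) ≡ c * Σ< n w
Σ<-*ˡ zero    c w = sym (*-zeroʳ c)
Σ<-*ˡ (suc n) c w = trans (cong (c * w 0 +_) (Σ<-*ˡ n c (w ∘ suc))) (sym (*-distribˡ-+ c (w 0) _))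

Σ<-comm : ∀ n m (w : ℕ → ℕ → ℕ) → Σ< n (λ i → Σ< m (w i)) ≡ Σ< m (λ j → Σ< n (λ i → w i j))
Σ<-comm zero    m w = sym (Σ<-zero m)
Σ<-comm (suc n) m w = trans (cong (Σ< m (w 0) +_) (Σ<-comm n m (w ∘ suc))) (sym (Σ<-+ m (w 0) _))

Σ<-+-range : ∀ p q (w : ℕ → ℕ) → Σ< (p + q) w ≡ Σ< p w + Σ< q (λ i → w (p + i))
Σ<-+-range zero    q w = refl
Σ<-+-range (suc p) q w = trans (cong (w 0 +_) (Σ<-+-range p q (w ∘ suc))) (sym (+-assoc (w 0) _ _))

Σ<-*-range : ∀ d q (w : ℕ → ℕ) → Σ< (d * q) w ≡ Σ< d (λ i → Σ< q (λ r → w (i * q + r)))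
Σ<-*-range zero    q w = refl
Σ<-*-range (suc d) q w = trans (Σ<-+-range q (d * q) w) (cong (Σ< q w +_) (trans (Σ<-*-range d q (λ x → w (q + x)))
  (Σ<-cong d (λ i _ → Σ<-cong q (λ r _ → cong w (sym (+-assoc q (i * q) r)))))))

Σ<-suc : ∀ n (w : ℕ → ℕ) → Σ< (suc n) w ≡ Σ< n w + w n
Σ<-suc zero    w = +-identityʳ (w 0)
Σ<-suc (suc n) w = trans (cong (w 0 +_) (Σ<-suc n (w ∘ suc))) (sym (+-assoc (w 0) _ _))

Σ<-select : ∀ n {D} (w : ℕ → ℕ) → 0 < D → D ≤ n → Σ< n (λ i → ind (suc i ≟ D) * w i) ≡ w (pred D)
Σ<-select (suc n) {1} w _ _ = begin
    1 * w 0 + Σ< n (λ i → ind (suc (suc i) ≟ 1) * w (suc i))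
  ≡⟨ cong₂ _+_ (*-identityˡ (w 0)) (trans (Σ<-cong n (λ i _ → cong (_* w (suc i)) (ind-no (suc (suc i) ≟ 1) λ ()))) (Σ<-zero n)) ⟩
    w 0 + 0
  ≡⟨ +-identityʳ (w 0) ⟩
    w 0
  ∎
  where open ≡-Reasoning
Σ<-select (suc n) {suc (suc j)} w _ (s≤s D≤n) = begin
    0 * w 0 + Σ< n (λ i → ind (suc (suc i) ≟ suc (suc j)) * w (suc i))
  ≡⟨ Σ<-cong n (λ i _ → cong (_* w (suc i)) (ind-⇔ (suc (suc i) ≟ suc (suc j)) (suc i ≟ suc j) suc-injective (cong suc))) ⟩
    Σ< n (λ i → ind (suc i ≟ suc j) * w (suc i))
  ≡⟨ Σ<-select n (w ∘ suc) z<s D≤n ⟩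
    w (suc j)
  ∎
  where open ≡-Reasoning

Σ<-*ʳ : ∀ n c (w : ℕ → ℕ) → Σ< n (λ i → w i * c) ≡ Σ< n w * c
Σ<-*ʳ n c w = trans (Σ<-cong n (λ i _ → *-comm (w i) c)) (trans (Σ<-*ˡ n c w) (*-comm c _))

sumOver-applyUpTo : ∀ (g : ℕ → A) n (h : A → ℕ) → sumOver (applyUpTo g n) h ≡ Σ< n (h ∘ g)
sumOver-applyUpTo g zero    h = refl
sumOver-applyUpTo g (suc n) h = cong (h (g 0) +_) (sumOver-applyUpTo (g ∘ suc) n h)

sumOver-allFin : ∀ n (w : ℕ → ℕ) → sumOver (allFin n) (w ∘ toℕ) ≡ Σ< n w
sumOver-allFin zero    w = refl
sumOver-allFin (suc n) w = trans (sumOver-allFin-suc {n} (w ∘ toℕ)) (cong (w 0 +_) (sumOver-allFin n (w ∘ suc)))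

-- φ counts over 1 … d; moving to 0 … d - 1 trades d for 0, and gcd d d = d = gcd 0 d.
φ≡Σ<-coprime : ∀ d → φ (suc d) ≡ Σ< (suc d) (λ i → ind (gcd i (suc d) ≟ 1))
φ≡Σ<-coprime d = begin
    φ (suc d)
  ≡⟨ count≡sumOver (λ i → gcd (suc i) (suc d) ≟ 1) (upTo (suc d)) ⟩
    sumOver (upTo (suc d)) (coprime ∘ suc)
  ≡⟨ sumOver-applyUpTo id (suc d) (coprime ∘ suc) ⟩
    Σ< (suc d) (coprime ∘ suc)
  ≡⟨ Σ<-suc d (coprime ∘ suc) ⟩
    Σ< d (coprime ∘ suc) + coprime (suc d)
  ≡⟨ +-comm (Σ< d (coprime ∘ suc)) (coprime (suc d)) ⟩
    coprime (suc d) + Σ< d (coprime ∘ suc)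
  ≡⟨ cong (_+ Σ< d (coprime ∘ suc)) (cong (λ e → ind (e ≟ 1)) (trans (gcd-idem (suc d)) (sym (gcd-identityˡ (suc d))))) ⟩
    Σ< (suc d) coprime
  ∎
  where
  open ≡-Reasoning
  coprime : ℕ → ℕ
  coprime i = ind (gcd i (suc d) ≟ 1)
  gcd-idem : ∀ m → gcd m m ≡ m
  gcd-idem m = GCD.unique (gcd-GCD m m) GCD.refl

module _ (n : ℕ) .{{_ : NonZero n}} where

  order∣n : ∀ x → order n x ∣ n
  order∣n x = divides (gcd x n) (trans (order*gcd n x) (*-comm (order n x) (gcd x n)))

  order-positive : ∀ x → 0 < order n x
  order-positive x = n≢0⇒n>0 (≢-nonZero⁻¹ _ {{order-nonZero n x}})

  order≤n : ∀ x → order n x ≤ n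
  order≤n x = ∣⇒≤ (order∣n x)

  private
    -- gcd (i q + r) n = q forces r = 0, and gcd (i q) n = q · gcd i d.
    blockSum : ∀ {q d} .{{_ : NonZero q}} → n ≡ q * d → ∀ i →
               Σ< q (λ r → ind (gcd (i * q + r) n ≟ q)) ≡ ind (gcd i d ≟ 1)
    blockSum {suc q′} {d} n≡q*d i = begin
        ind (gcd (i * q + 0) n ≟ q) + Σ< q′ (λ r → ind (gcd (i * q + suc r) n ≟ q))
      ≡⟨ cong₂ _+_ (ind-⇔ (gcd (i * q + 0) n ≟ q) (gcd i d ≟ 1)
                      (λ eq → *-cancelˡ-≡ _ _ q (trans (sym gcd-block) (trans eq (sym (*-identityʳ q)))))
                      (λ eq → trans gcd-block (trans (cong (q *_) eq) (*-identityʳ q))))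
                   (trans (Σ<-cong q′ {λ r → ind (gcd (i * q + suc r) n ≟ q)}
                                   (λ r r<q′ → ind-no (gcd (i * q + suc r) n ≟ q) (not-q r r<q′)))
                          (Σ<-zero q′)) ⟩
        ind (gcd i d ≟ 1) + 0
      ≡⟨ +-identityʳ _ ⟩
        ind (gcd i d ≟ 1)
      ∎
      where
      open ≡-Reasoning
      q = suc q′
      gcd-block : gcd (i * q + 0) n ≡ q * gcd i d
      gcd-block = trans (cong₂ gcd (trans (+-identityʳ _) (*-comm i q)) n≡q*d) (sym (c*gcd[m,n]≡gcd[cm,cn] q i d))
      not-q : ∀ r → r < q′ → gcd (i * q + suc r) n ≢ q
      not-q r r<q′ eq = <⇒≱ (s<s r<q′)
        (∣⇒≤ (∣m+n∣m⇒∣n (subst (_∣ i * q + suc r) eq (gcd[m,n]∣m _ n)) (n∣m*n i)))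

  count-order : ∀ i → Σ< n (λ x → ind (suc i ≟ order n x)) ≡ ind (suc i ∣? n) * φ (suc i)
  count-order i with suc i ∣? n
  ... | no ∤n = trans (Σ<-cong n (λ x _ → ind-no (suc i ≟ order n x) (λ eq → ∤n (subst (_∣ n) (sym eq) (order∣n x)))))
                      (Σ<-zero n)
  ... | yes (divides zero n≡0) = ⊥-elim (≢-nonZero⁻¹ n n≡0)
  ... | yes (divides q@(suc _) n≡q*d) = begin
      Σ< n (λ x → ind (d ≟ order n x))
    ≡⟨ Σ<-cong n (λ x _ → ind-⇔ (d ≟ order n x) (gcd x n ≟ q) (order≡⇒gcd≡ x) (gcd≡⇒order≡ x)) ⟩
      Σ< n (λ x → ind (gcd x n ≟ q))
    ≡⟨ cong (λ N → Σ< N (λ x → ind (gcd x n ≟ q))) (trans n≡q*d (*-comm q d)) ⟩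
      Σ< (d * q) (λ x → ind (gcd x n ≟ q))
    ≡⟨ Σ<-*-range d q (λ x → ind (gcd x n ≟ q)) ⟩
      Σ< d (λ i′ → Σ< q (λ r → ind (gcd (i′ * q + r) n ≟ q)))
    ≡⟨ Σ<-cong d (λ i′ _ → blockSum {q} {d} n≡q*d i′) ⟩
      Σ< d (λ i′ → ind (gcd i′ d ≟ 1))
    ≡⟨ sym (φ≡Σ<-coprime i) ⟩
      φ d
    ≡⟨ sym (+-identityʳ (φ d)) ⟩
      1 * φ d
    ∎
    where
    open ≡-Reasoning
    d = suc i
    order≡⇒gcd≡ : ∀ x → d ≡ order n x → gcd x n ≡ q
    order≡⇒gcd≡ x eq = *-cancelʳ-≡ (gcd x n) q d (begin
        gcd x n * d              ≡⟨ cong (gcd x n *_) eq ⟩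
        gcd x n * order n x      ≡⟨ *-comm (gcd x n) (order n x) ⟩
        order n x * gcd x n      ≡⟨ sym (order*gcd n x) ⟩
        n                        ≡⟨ n≡q*d ⟩
        q * d                    ∎)
    gcd≡⇒order≡ : ∀ x → gcd x n ≡ q → d ≡ order n x
    gcd≡⇒order≡ x eq = sym (begin
        order n x                ≡⟨ /-congʳ {{gcd-nonZero x n}} eq ⟩
        n / q                    ≡⟨ /-congˡ (trans n≡q*d (*-comm q d)) ⟩
        d * q / q                ≡⟨ m*n/n≡m d q ⟩
        d                        ∎)

  sumDiv≡Σ< : ∀ (g : ℕ → ℕ) → sumDiv n g ≡ Σ< n (λ i → ind (suc i ∣? n) * g i)
  sumDiv≡Σ< g = begin
      sumDiv n g
    ≡⟨ sum-map g (filter (λ i → suc i ∣? n) (upTo n)) ⟩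
      sumOver (filter (λ i → suc i ∣? n) (upTo n)) g
    ≡⟨ sumOver-filter (λ i → suc i ∣? n) (upTo n) g ⟩
      sumOver (upTo n) (λ i → ind (suc i ∣? n) * g i)
    ≡⟨ sumOver-applyUpTo id n _ ⟩
      Σ< n (λ i → ind (suc i ∣? n) * g i)
    ∎
    where open ≡-Reasoning

  sumDiv-cong : ∀ {g g′ : ℕ → ℕ} → (∀ i → suc i ∣ n → g i ≡ g′ i) → sumDiv n g ≡ sumDiv n g′
  sumDiv-cong {g} {g′} eq = trans (sumDiv≡Σ< g) (trans (Σ<-cong n (λ i _ → termwise i)) (sym (sumDiv≡Σ< g′)))
    where
    termwise : ∀ i → ind (suc i ∣? n) * g i ≡ ind (suc i ∣? n) * g′ i
    termwise i with suc i ∣? n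
    ... | yes i∣n = cong (1 *_) (eq i i∣n)
    ... | no _    = refl

  sum-by-order : ∀ (H : ℕ → ℕ) →
    sumOver (allFin n) (λ a → H (pred (order n (toℕ a)))) ≡ sumDiv n (λ i → φ (suc i) * H i)
  sum-by-order H = begin
      sumOver (allFin n) (λ a → H (pred (order n (toℕ a))))
    ≡⟨ sumOver-allFin n (λ x → H (pred (order n x))) ⟩
      Σ< n (λ x → H (pred (order n x)))
    ≡⟨ Σ<-cong n (λ x _ → sym (Σ<-select n H (order-positive x) (order≤n x))) ⟩
      Σ< n (λ x → Σ< n (λ i → ind (suc i ≟ order n x) * H i))
    ≡⟨ Σ<-comm n n (λ x i → ind (suc i ≟ order n x) * H i) ⟩
      Σ< n (λ i → Σ< n (λ x → ind (suc i ≟ order n x) * H i))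
    ≡⟨ Σ<-cong n (λ i _ → trans (Σ<-*ʳ n (H i) _) (cong (_* H i) (count-order i))) ⟩
      Σ< n (λ i → ind (suc i ∣? n) * φ (suc i) * H i)
    ≡⟨ Σ<-cong n (λ i _ → *-assoc (ind (suc i ∣? n)) (φ (suc i)) (H i)) ⟩
      Σ< n (λ i → ind (suc i ∣? n) * (φ (suc i) * H i))
    ≡⟨ sym (sumDiv≡Σ< (λ i → φ (suc i) * H i)) ⟩
      sumDiv n (λ i → φ (suc i) * H i)
    ∎
    where open ≡-Reasoning

data EvenOdd (n : ℕ) : Set where
  even : ∀ h → n ≡ h + h → EvenOdd n
  odd  : ∀ h → n ≡ suc (h + h) → EvenOdd n

evenOdd : ∀ n → EvenOdd n
evenOdd zero = even 0 refl
evenOdd (suc n) with evenOdd n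
... | even h n≡h+h = odd h (cong suc n≡h+h)
... | odd h n≡1+h+h = even (suc h) (cong suc (trans n≡1+h+h (sym (+-suc h h))))

2∣double : ∀ h → 2 ∣ h + h
2∣double h = divides h (double≡*2 h)
  where double≡*2 : ∀ h → h + h ≡ h * 2
        double≡*2 = solve-∀

2∤odd : ∀ h → ¬ 2 ∣ suc (h + h)
2∤odd h 2∣odd with ∣⇒≤ (∣m+n∣m⇒∣n (subst (2 ∣_) (+-comm 1 (h + h)) 2∣odd) (2∣double h))
... | s≤s ()

lcm-even-2 : ∀ i t → suc i ≡ t + t → lcm (suc i) 2 ≡ suc i
lcm-even-2 i t i+1≡t+t = trans (cong (suc i *_) (/-congʳ {{_}} {{_}} gcd≡2)) (*-identityʳ (suc i))
  where gcd≡2 : gcd (suc i) 2 ≡ 2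
        gcd≡2 = GCD.unique (gcd-GCD (suc i) 2) (GCD.is (subst (2 ∣_) (sym i+1≡t+t) (2∣double t) , ∣-refl) proj₂)

lcm-odd-2 : ∀ i t → suc i ≡ suc (t + t) → lcm (suc i) 2 ≡ suc i * 2
lcm-odd-2 i t i+1≡1+t+t = cong (suc i *_) (/-congʳ {{_}} {{_}} gcd≡1)
  where gcd≡1 : gcd (suc i) 2 ≡ 1
        gcd≡1 = GCD.unique (gcd-GCD (suc i) 2) (GCD.is (1∣ suc i , 1∣ 2) λ { {c} (c∣D , c∣2) →
                  ∣m+n∣m⇒∣n (subst (c ∣_) (trans i+1≡1+t+t (+-comm 1 (t + t))) c∣D) (∣-trans c∣2 (2∣double t)) })

pow-r2f-double : ∀ t → pow r2f (t + t) ≡ e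
pow-r2f-double zero    = refl
pow-r2f-double (suc t) rewrite +-suc t t | pow-r2f-double t = refl

pow-r2f-odd : ∀ t → pow r2f (suc (t + t)) ≡ r2f
pow-r2f-odd t rewrite pow-r2f-double t = refl

/-exact : ∀ q D x .{{_ : NonZero D}} → q * D * x / D ≡ q * x
/-exact q D x = trans (/-congˡ (regroup q D x)) (m*n/n≡m (q * x) D)
  where regroup : ∀ q D x → q * D * x ≡ q * x * D
        regroup = solve-∀

/-exact-half : ∀ q i h → q * suc i * (h + h) / (suc i * 2) ≡ q * h
/-exact-half q i h = trans (/-congˡ (regroup q (suc i) h)) (m*n/n≡m (q * h) (suc i * 2))
  where regroup : ∀ q D h → q * D * (h + h) ≡ q * h * (D * 2)
        regroup = solve-∀

^-*-assoc′ : ∀ x a q → (x ^ a) ^ q ≡ x ^ (q * a)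
^-*-assoc′ x a q = trans (^-*-assoc x a q) (cong (x ^_) (*-comm a q))

^-distribʳ-* : ∀ x y q → (x * y) ^ q ≡ x ^ q * y ^ q
^-distribʳ-* x y zero    = refl
^-distribʳ-* x y (suc q) rewrite ^-distribʳ-* x y q = shuffle x y (x ^ q) (y ^ q)
  where shuffle : ∀ x y a b → x * y * (a * b) ≡ x * a * (y * b)
        shuffle = solve-∀

module Tilings {R : Subgroup} (r2f∈R : T (inR R r2f)) {k : ℕ} (Td : TileDesigns R k) where

  g-involutive : ∀ v → act Td r2f r2f∈R (act Td r2f r2f∈R v) ≡ v
  g-involutive v = trans (act-mul Td r2f r2f r2f∈R r2f∈R v)
                         (trans (cong (λ p → act Td e p v) (T-irrelevant _ (id∈ R))) (act-id Td v))

  open Columns (act Td r2f r2f∈R) g-involutive public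

  tfix-cong : ∀ {g h} → g ≡ h → (p : T (inR R g)) (q : T (inR R h)) → tfix Td g p ≡ tfix Td h q
  tfix-cong refl p q = cong (tfix Td _) (T-irrelevant p q)

  tfix-id : tfix Td e (id∈ R) ≡ k
  tfix-id = begin
      tfix Td e (id∈ R)
    ≡⟨ count≡sumOver _ (allFin k) ⟩
      sumOver (allFin k) (λ v → ind (act Td e (id∈ R) v ≟ᶠ v))
    ≡⟨ sumOver-cong (allFin k) (λ v → ind-yes (act Td e (id∈ R) v ≟ᶠ v) (act-id Td v)) ⟩
      sumOver (allFin k) (λ _ → 1)
    ≡⟨ trans (sumOver-allFin-const k 1) (*-identityʳ k) ⟩
      k
    ∎
    where open ≡-Reasoning

  tfix-r2f : tfix Td r2f r2f∈R ≡ fixedTiles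
  tfix-r2f = count≡sumOver _ (allFin k)

  numFixed≡columns^gcd : ∀ n m .{{_ : NonZero n}} (a : Fin n) →
              numFixed n m Td r2f∈R a ≡ fixedColumns m (order n (toℕ a)) ^ gcd (toℕ a) n
  numFixed≡columns^gcd n m a = begin
      numFixed n m Td r2f∈R a
    ≡⟨ count≡sumOver (fixedBy? Td r2f∈R a) (allTilings n m k) ⟩
      sumOver (allTilings n m k) (ind ∘ fixedBy? Td r2f∈R a)
    ≡⟨ sumOver-cong (allTilings n m k) (λ τ →
         ind-⇔ (fixedBy? Td r2f∈R a τ) (equivariant? a τ) (fixed⇒equivariant τ) (equivariant⇒fixed τ)) ⟩
      sumOver (allTilings n m k) (ind ∘ equivariant? a)
    ≡⟨ count-equivariant a ⟩
      fixedColumns m (order n (toℕ a)) ^ gcd (toℕ a) n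
    ∎
    where
    open ≡-Reasoning
    module Tiles = Orbits (vecSetoid m) (allFuns (allFin k) m) (allFuns-once m) flip flip-cong
    open Tiles using (equivariant?; count-equivariant)
    fixed⇒equivariant : ∀ τ → FixedBy Td r2f∈R a τ → Tiles.Equivariant a τ
    fixed⇒equivariant τ fixed x y = trans (cong (τ (x +ₙ a)) (sym (Fin.opposite-involutive y))) (fixed x (opposite y))
    equivariant⇒fixed : ∀ τ → Tiles.Equivariant a τ → FixedBy Td r2f∈R a τ
    equivariant⇒fixed τ eqv x y = trans (eqv x (opposite y)) (cong (act Td r2f r2f∈R ∘ τ x) (Fin.opposite-involutive y))

  module _ (n m : ℕ) .{{_ : NonZero n}} where

    FixCyl≡sumDiv : FixCyl n m Td r2f∈R ≡ sumDiv n (λ i → φ (suc i) * fixedColumns m (suc i) ^ (n / suc i))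
    FixCyl≡sumDiv = begin
        FixCyl n m Td r2f∈R
      ≡⟨ sum-map (numFixed n m Td r2f∈R) (allFin n) ⟩
        sumOver (allFin n) (numFixed n m Td r2f∈R)
      ≡⟨ sumOver-cong (allFin n) (λ a →
           trans (numFixed≡columns^gcd n m a) (by-order (order*gcd n (toℕ a)) {{order-nonZero n (toℕ a)}})) ⟩
        sumOver (allFin n) (λ a → H (pred (order n (toℕ a))))
      ≡⟨ sum-by-order n H ⟩
        sumDiv n (λ i → φ (suc i) * H i)
      ∎
      where
      open ≡-Reasoning
      H : ℕ → ℕ
      H i = fixedColumns m (suc i) ^ (n / suc i)
      by-order : ∀ {o g} → n ≡ o * g → .{{_ : NonZero o}} → fixedColumns m o ^ g ≡ H (pred o)
      by-order {suc o} {g} n≡o*g = cong (fixedColumns m (suc o) ^_)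
        (sym (trans (/-congˡ (trans n≡o*g (*-comm (suc o) g))) (m*n/n≡m g (suc o))))

    private
      quotient : ∀ q i → n ≡ q * suc i → n / suc i ≡ q
      quotient q i n≡q*d = trans (/-congˡ n≡q*d) (m*n/n≡m q (suc i))

      exponent : ∀ h q d → m ≡ suc (h + h) → n ≡ q * d → n * m ∸ n ≡ q * d * (h + h)
      exponent h q d m≡1+h+h n≡q*d = begin
        n * m ∸ n               ≡⟨ cong (λ x → n * x ∸ n) m≡1+h+h ⟩
        n * suc (h + h) ∸ n     ≡⟨ cong (_∸ n) (*-suc n (h + h)) ⟩
        n + n * (h + h) ∸ n     ≡⟨ m+n∸m≡n n (n * (h + h)) ⟩
        n * (h + h)             ≡⟨ cong (_* (h + h)) n≡q*d ⟩
        q * d * (h + h)         ∎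
        where open ≡-Reasoning

    idFactor : ℕ → ℕ → ℕ
    idFactor i x = tfix Td e (id∈ R) ^ (_/_ x (lcm (suc i) 2) {{lcm-d-2-nonZero i}})

    rotationFactor : ℕ → ℕ
    rotationFactor i = tfix Td (pow r2f (suc i)) (pow∈ R r2f r2f∈R (suc i)) ^ (n / suc i)

    private
      idFactor-even : ∀ {i} t q x → suc i ≡ t + t → idFactor i (q * suc i * x) ≡ k ^ (q * x)
      idFactor-even {i} t q x d≡t+t = cong₂ _^_ tfix-id
        (trans (/-congʳ {{lcm-d-2-nonZero i}} {{_}} (lcm-even-2 i t d≡t+t)) (/-exact q (suc i) x))

      idFactor-odd : ∀ {i} t q h → suc i ≡ suc (t + t) → idFactor i (q * suc i * (h + h)) ≡ k ^ (q * h)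
      idFactor-odd {i} t q h d≡1+t+t = cong₂ _^_ tfix-id
        (trans (/-congʳ {{lcm-d-2-nonZero i}} {{_}} (lcm-odd-2 i t d≡1+t+t)) (/-exact-half q i h))

      rotationFactor-even : ∀ {i} t q → suc i ≡ t + t → n ≡ q * suc i → rotationFactor i ≡ k ^ q
      rotationFactor-even {i} t q d≡t+t n≡q*d = cong₂ _^_
        (trans (tfix-cong (trans (cong (pow r2f) d≡t+t) (pow-r2f-double t)) _ _) tfix-id) (quotient q i n≡q*d)

      rotationFactor-odd : ∀ {i} t q → suc i ≡ suc (t + t) → n ≡ q * suc i → rotationFactor i ≡ fixedTiles ^ q
      rotationFactor-odd {i} t q d≡1+t+t n≡q*d = cong₂ _^_
        (trans (tfix-cong (trans (cong (pow r2f) d≡1+t+t) (pow-r2f-odd t)) _ _) tfix-r2f) (quotient q i n≡q*d)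

    columnFactor-even : ∀ {h i} → m ≡ h + h → suc i ∣ n →
      fixedColumns m (suc i) ^ (n / suc i) ≡ idFactor i (n * m)
    columnFactor-even {h} {i} m≡h+h (divides q n≡q*d) with evenOdd (suc i)
    ... | even t d≡t+t = begin
        fixedColumns m (suc i) ^ (n / suc i)
          ≡⟨ cong₂ _^_ (trans (cong (fixedColumns m) d≡t+t) (fixedColumns-even m t)) (quotient q i n≡q*d) ⟩
        (k ^ m) ^ q                 ≡⟨ ^-*-assoc′ k m q ⟩
        k ^ (q * m)                 ≡⟨ sym (idFactor-even t q m d≡t+t) ⟩
        idFactor i (q * suc i * m)  ≡⟨ cong (λ x → idFactor i (x * m)) (sym n≡q*d) ⟩
        idFactor i (n * m)          ∎
      where open ≡-Reasoning
    ... | odd t d≡1+t+t = begin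
        fixedColumns m (suc i) ^ (n / suc i)
          ≡⟨ cong₂ _^_ (trans (cong (fixedColumns m) d≡1+t+t) (fixedColumns-odd m t)) (quotient q i n≡q*d) ⟩
        symmetricColumns m ^ q            ≡⟨ cong (λ x → symmetricColumns x ^ q) m≡h+h ⟩
        symmetricColumns (h + h) ^ q      ≡⟨ cong (_^ q) (symmetricColumns-even h) ⟩
        (k ^ h) ^ q                       ≡⟨ ^-*-assoc′ k h q ⟩
        k ^ (q * h)                       ≡⟨ sym (idFactor-odd t q h d≡1+t+t) ⟩
        idFactor i (q * suc i * (h + h))  ≡⟨ cong (idFactor i) (sym (cong₂ _*_ n≡q*d m≡h+h)) ⟩
        idFactor i (n * m)                ∎
      where open ≡-Reasoning

    columnFactor-odd : ∀ {h i} → m ≡ suc (h + h) → suc i ∣ n →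
      fixedColumns m (suc i) ^ (n / suc i) ≡ idFactor i (n * m ∸ n) * rotationFactor i
    columnFactor-odd {h} {i} m≡1+h+h (divides q n≡q*d) with evenOdd (suc i)
    ... | even t d≡t+t = begin
        fixedColumns m (suc i) ^ (n / suc i)
          ≡⟨ cong₂ _^_ (trans (cong (fixedColumns m) d≡t+t) (fixedColumns-even m t)) (quotient q i n≡q*d) ⟩
        (k ^ m) ^ q                 ≡⟨ ^-*-assoc′ k m q ⟩
        k ^ (q * m)                 ≡⟨ cong (λ x → k ^ (q * x)) m≡1+h+h ⟩
        k ^ (q * suc (h + h))       ≡⟨ cong (k ^_) (trans (*-suc q (h + h)) (+-comm q _)) ⟩
        k ^ (q * (h + h) + q)       ≡⟨ ^-distribˡ-+-* k (q * (h + h)) q ⟩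
        k ^ (q * (h + h)) * k ^ q
          ≡⟨ sym (cong₂ _*_ (idFactor-even t q (h + h) d≡t+t) (rotationFactor-even t q d≡t+t n≡q*d)) ⟩
        idFactor i (q * suc i * (h + h)) * rotationFactor i
          ≡⟨ cong (λ x → idFactor i x * rotationFactor i) (sym (exponent h q (suc i) m≡1+h+h n≡q*d)) ⟩
        idFactor i (n * m ∸ n) * rotationFactor i ∎
      where open ≡-Reasoning
    ... | odd t d≡1+t+t = begin
        fixedColumns m (suc i) ^ (n / suc i)
          ≡⟨ cong₂ _^_ (trans (cong (fixedColumns m) d≡1+t+t) (fixedColumns-odd m t)) (quotient q i n≡q*d) ⟩
        symmetricColumns m ^ q             ≡⟨ cong (λ x → symmetricColumns x ^ q) m≡1+h+h ⟩
        symmetricColumns (suc (h + h)) ^ q ≡⟨ cong (_^ q) (symmetricColumns-odd h) ⟩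
        (k ^ h * fixedTiles) ^ q           ≡⟨ ^-distribʳ-* (k ^ h) fixedTiles q ⟩
        (k ^ h) ^ q * fixedTiles ^ q       ≡⟨ cong (_* fixedTiles ^ q) (^-*-assoc′ k h q) ⟩
        k ^ (q * h) * fixedTiles ^ q
          ≡⟨ sym (cong₂ _*_ (idFactor-odd t q h d≡1+t+t) (rotationFactor-odd t q d≡1+t+t n≡q*d)) ⟩
        idFactor i (q * suc i * (h + h)) * rotationFactor i
          ≡⟨ cong (λ x → idFactor i x * rotationFactor i) (sym (exponent h q (suc i) m≡1+h+h n≡q*d)) ⟩
        idFactor i (n * m ∸ n) * rotationFactor i ∎
      where open ≡-Reasoning

    FixCyl-even : 2 ∣ m → FixCyl n m Td r2f∈R ≡ sumDiv n (λ i → φ (suc i) * idFactor i (n * m))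
    FixCyl-even 2∣m with evenOdd m
    ... | even h m≡h+h  = trans FixCyl≡sumDiv (sumDiv-cong n (λ i i∣n →
          cong (φ (suc i) *_) (columnFactor-even {h} m≡h+h i∣n)))
    ... | odd h m≡1+h+h = ⊥-elim (2∤odd h (subst (2 ∣_) m≡1+h+h 2∣m))

    FixCyl-odd : ¬ 2 ∣ m →
      FixCyl n m Td r2f∈R ≡ sumDiv n (λ i → φ (suc i) * idFactor i (n * m ∸ n) * rotationFactor i)
    FixCyl-odd 2∤m with evenOdd m
    ... | even h m≡h+h  = ⊥-elim (2∤m (subst (2 ∣_) (sym m≡h+h) (2∣double h)))
    ... | odd h m≡1+h+h = trans FixCyl≡sumDiv (sumDiv-cong n (λ i i∣n →
          trans (cong (φ (suc i) *_) (columnFactor-odd {h} m≡1+h+h i∣n)) (sym (*-assoc (φ (suc i)) _ _))))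

mainTheorem8 : (n m : ℕ) .{{_ : NonZero n}} .{{_ : NonZero m}} →
    (R : Subgroup) (r2f∈R : T (inR R r2f)) (k : ℕ) (Td : TileDesigns R k) →
    (2 ∣ m → FixCyl n m Td r2f∈R ≡
       sumDiv n (λ i → φ (suc i) *
         tfix Td e (id∈ R) ^ (_/_ (n * m) (lcm (suc i) 2) {{lcm-d-2-nonZero i}})))
    × (¬ (2 ∣ m) → FixCyl n m Td r2f∈R ≡
       sumDiv n (λ i → φ (suc i) *
         tfix Td e (id∈ R) ^ (_/_ (n * m ∸ n) (lcm (suc i) 2) {{lcm-d-2-nonZero i}}) *
         tfix Td (pow r2f (suc i)) (pow∈ R r2f r2f∈R (suc i)) ^ (n / suc i)))
mainTheorem8 n m R r2f∈R k Td = FixCyl-even n m , FixCyl-odd n m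
  where open Tilings r2f∈R Td
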